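{- Let $s^{\mathrm{int}}(n)$ denote the minimum number of edges in an $n$-vertex graph that is interval-universal for trees. Then $s^{\mathrm{int}}(n)\geq (1-o(1))\,n\log_2 n$.
   Context: An $n$-vertex graph $G$ is interval-universal (for trees) if there is an ordering $x_1,\dots,x_n$ of $V(G)$ such that for all integers $i,m\geq 0$ (with $i+m\leq n$) the induced subgraph $G[\{x_{i+1},\dots,x_{i+m}\}]$ contains every $m$-vertex tree as a subgraph. -}

module Defs where

open import Data.Nat using (ℕ; zero; suc; _+_; _*_; _^_; _≤_; _<_)
open import Data.Fin using (Fin; toℕ; inject₁; fromℕ; _<?_)
import Data.Fin as F
open import Data.Bool using (Bool; true; false)
open import Data.List using (List; map; allFin)
open import Data.Nat.ListAction using (sum)
open import Data.Product using (Σ; _×_; ∃; ∃-syntax)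
open import Relation.Binary.PropositionalEquality using (_≡_)
open import Relation.Nullary using (¬_; does)
open import Function.Definitions using (Injective)
open import Function.Bundles using (_↔_)

record SimpleGraph (n : ℕ) : Set where
  field
    adj    : Fin n → Fin n → Bool
    sym    : ∀ u v → adj u v ≡ adj v u
    irrefl : ∀ u → adj u u ≡ false
open SimpleGraph public

Adj : ∀ {n} → SimpleGraph n → Fin n → Fin n → Set
Adj G u v = adj G u v ≡ true

edgeCount : ∀ {n} → SimpleGraph n → ℕ
edgeCount {n} G =
  sum (map (λ u → sum (map (λ v → indicator u v) (allFin n))) (allFin n))
  where
    indicator : Fin n → Fin n → ℕ
    indicator u v with does (u <? v) | adj G u v
    ... | true | true = 1
    ... | _    | _    = 0

data Walk {n} (G : SimpleGraph n) : Fin n → Fin n → Set where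
  nil  : ∀ {u} → Walk G u u
  cons : ∀ {u v w} → Adj G u v → Walk G v w → Walk G u w

Connected : ∀ {n} → SimpleGraph n → Set
Connected G = ∀ u v → Walk G u v

HasCycle : ∀ {n} → SimpleGraph n → Set
HasCycle {n} G =
  ∃[ l ] Σ (Fin (3 + l) → Fin n) λ c →
    Injective _≡_ _≡_ c
    × (∀ (j : Fin (2 + l)) → Adj G (c (inject₁ j)) (c (F.suc j)))
    × Adj G (c (fromℕ (2 + l))) (c F.zero)

IsTree : ∀ {m} → SimpleGraph m → Set
IsTree T = Connected T × ¬ HasCycle T

-- An ordering x_1,...,x_n of V(G) is a bijection
-- ord : Fin n ↔ Fin n, position p (0-based) ↦ vertex x_{p+1}.
-- G[{x_{i+1},...,x_{i+m}}] contains T as a subgraph iff there is an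
-- injective map φ from V(T) into the positions i,...,i+m-1 sending
-- edges of T to edges of G.
ContainsInInterval : ∀ {n m} → SimpleGraph n → (Fin n → Fin n) → ℕ → SimpleGraph m → Set
ContainsInInterval {n} {m} G ord i T =
  Σ (Fin m → Fin n) λ φ →
    Injective _≡_ _≡_ φ
    × (∀ a → i ≤ toℕ (φ a) × toℕ (φ a) < i + m)
    × (∀ a b → Adj T a b → Adj G (ord (φ a)) (ord (φ b)))

IntervalUniversal : ∀ {n} → SimpleGraph n → Set
IntervalUniversal {n} G =
  Σ (Fin n ↔ Fin n) λ ord →
    ∀ (i m : ℕ) → i + m ≤ n →
      ∀ (T : SimpleGraph m) → IsTree T →
        ContainsInInterval G (Function.Bundles.Inverse.to ord) i T

-- In an interval-universal ordering every interval I of positions contains a spanning star, whose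
-- centre h is adjacent to all other vertices of I. Splitting I at h into intervals of lengths a and b,
-- the number of edges inside I is at least e(left) + e(right) + (a + b). The least function obeying this
-- recursion is sumLog₂ m = Σ_{j ≤ m} ⌊log₂ j⌋ (balanced splits attain it), so e(G) ≥ sumLog₂ n, and
-- sumLog₂ n ≥ n log₂ n − 3n gives the bound as soon as n ≥ 2^(3k).

module Submission where

open import Defs hiding (sym)
open import Data.Nat using (ℕ; _+_; _*_; _^_; _≤_; _∸_)
open import Data.Product using (∃-syntax)

open import Data.Nat as ℕ using (zero; suc; _<_; z≤n; s≤s; z<s; s≤s⁻¹; NonZero; ⌈_/2⌉)
open import Data.Nat.Properties
open import Data.Nat.Induction using (<-rec)
open import Data.Nat.Logarithm
open import Data.Nat.Binary.Base as ℕᵇ using (2[1+_]; 1+[2_])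
import Data.Nat.Binary.Properties as ℕᵇ
import Data.Nat.ListAction as List
open import Data.Nat.Tactic.RingSolver using (solve-∀)
open import Data.Fin as Fin using (Fin; zero; suc; toℕ; fromℕ<; punchOut)
import Data.Fin.Properties as Fin
open import Data.Bool using (Bool; true; false; _∧_; if_then_else_)
open import Data.Empty using (⊥)
open import Data.List using (map; allFin; tabulate)
open import Data.List.Properties using (map-tabulate)
open import Data.Product using (Σ; _×_; _,_; proj₁; proj₂; ∃; ∃₂; map₂)
open import Data.Sum using (inj₁; inj₂)
open import Function.Base using (_∘_; id; flip)
open import Function.Bundles using (_↔_; Inverse)
open import Function.Definitions using (Injective; StrictlySurjective)
open import Function.Consequences.Propositional using (contraInjective)
open import Relation.Binary using (tri<; tri≈; tri>)
open import Relation.Binary.PropositionalEquality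
open import Relation.Nullary using (¬_; yes; no; does; contradiction)
open import Relation.Nullary.Decidable using (dec-true)
open import Algebra.Properties.CommutativeSemigroup +-commutativeSemigroup using (xy∙z≈xz∙y; interchange)
open import Algebra.Properties.CommutativeMonoid.Sum +-0-commutativeMonoid
  using (sum-syntax; sum-cong-≗; ∑-permute)

open ≤-Reasoning

2*n≡n+n : ∀ n → 2 * n ≡ n + n
2*n≡n+n n = cong (n +_) (+-identityʳ n)

binary-induction : (P : ℕ → Set) → P 1 →
                   (∀ n → P (suc n) → P (suc n + suc n)) →
                   (∀ n → P (suc n) → P (suc (suc n + suc n))) →
                   ∀ n → P (suc n)
binary-induction P one double double+1 n =
  subst (P ∘ ℕ.suc) (ℕᵇ.toℕ-fromℕ n) (go (ℕᵇ.fromℕ n))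
  where
  go : ∀ x → P (suc (ℕᵇ.toℕ x))
  go ℕᵇ.zero  = one
  go 2[1+ x ] = subst (P ∘ ℕ.suc) (sym (2*n≡n+n (suc m))) (double+1 m (go x))
    where m : ℕ
          m = ℕᵇ.toℕ x
  go 1+[2 x ] = subst P (trans (+-suc (suc m) m) (cong (ℕ.suc ∘ ℕ.suc) (sym (2*n≡n+n m)))) (double m (go x))
    where m : ℕ
          m = ℕᵇ.toℕ x

⌊log₂[n+n]⌋≡1+⌊log₂n⌋ : ∀ n .{{_ : NonZero n}} → ⌊log₂ (n + n) ⌋ ≡ 1 + ⌊log₂ n ⌋
⌊log₂[n+n]⌋≡1+⌊log₂n⌋ n = trans (cong ⌊log₂_⌋ (sym (2*n≡n+n n))) (⌊log₂[2*b]⌋≡1+⌊log₂b⌋ n)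

⌊log₂[1+n+n]⌋≡1+⌊log₂n⌋ : ∀ n .{{_ : NonZero n}} → ⌊log₂ suc (n + n) ⌋ ≡ 1 + ⌊log₂ n ⌋
⌊log₂[1+n+n]⌋≡1+⌊log₂n⌋ n = begin-equality
  ⌊log₂ suc (n + n) ⌋          ≡⟨ m∸n+n≡m 1≤log ⟨
  ⌊log₂ suc (n + n) ⌋ ∸ 1 + 1  ≡⟨ cong (_+ 1) (⌊log₂⌊n/2⌋⌋≡⌊log₂n⌋∸1 (suc (n + n))) ⟨
  ⌊log₂ ⌈ n + n /2⌉ ⌋ + 1      ≡⟨ cong (λ k → ⌊log₂ k ⌋ + 1) (n≡⌈n+n/2⌉ n) ⟨
  ⌊log₂ n ⌋ + 1                ≡⟨ +-comm ⌊log₂ n ⌋ 1 ⟩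
  1 + ⌊log₂ n ⌋                ∎
  where
  1≤log : 1 ≤ ⌊log₂ suc (n + n) ⌋
  1≤log = begin
    1                    ≤⟨ m≤m+n 1 ⌊log₂ n ⌋ ⟩
    1 + ⌊log₂ n ⌋        ≡⟨ ⌊log₂[n+n]⌋≡1+⌊log₂n⌋ n ⟨
    ⌊log₂ (n + n) ⌋      ≤⟨ ⌊log₂⌋-mono-≤ (n≤1+n (n + n)) ⟩
    ⌊log₂ suc (n + n) ⌋  ∎

n<2^[1+⌊log₂n⌋] : ∀ n → n < 2 ^ suc ⌊log₂ n ⌋
n<2^[1+⌊log₂n⌋] zero    = s≤s z≤n
n<2^[1+⌊log₂n⌋] (suc n) = binary-induction (λ n → n < 2 ^ suc ⌊log₂ n ⌋) ≤-refl double double+1 n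
  where
  double : ∀ n → suc n < 2 ^ suc ⌊log₂ suc n ⌋ → suc n + suc n < 2 ^ suc ⌊log₂ (suc n + suc n) ⌋
  double n lt = begin-strict
    suc n + suc n                       <⟨ +-mono-< lt lt ⟩
    2 ^ suc ⌊log₂ suc n ⌋ + 2 ^ suc ⌊log₂ suc n ⌋  ≡⟨ 2*n≡n+n (2 ^ suc ⌊log₂ suc n ⌋) ⟨
    2 ^ suc (1 + ⌊log₂ suc n ⌋)         ≡⟨ cong (λ k → 2 ^ suc k) (⌊log₂[n+n]⌋≡1+⌊log₂n⌋ (suc n)) ⟨
    2 ^ suc ⌊log₂ (suc n + suc n) ⌋     ∎
  double+1 : ∀ n → suc n < 2 ^ suc ⌊log₂ suc n ⌋ → suc (suc n + suc n) < 2 ^ suc ⌊log₂ suc (suc n + suc n) ⌋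
  double+1 n lt = begin-strict
    suc (suc n + suc n)                 <⟨ s≤s (≤-reflexive (sym (+-suc (suc n) (suc n)))) ⟩
    suc (suc n) + suc (suc n)           ≤⟨ +-mono-≤ lt lt ⟩
    2 ^ suc ⌊log₂ suc n ⌋ + 2 ^ suc ⌊log₂ suc n ⌋  ≡⟨ 2*n≡n+n (2 ^ suc ⌊log₂ suc n ⌋) ⟨
    2 ^ suc (1 + ⌊log₂ suc n ⌋)         ≡⟨ cong (λ k → 2 ^ suc k) (⌊log₂[1+n+n]⌋≡1+⌊log₂n⌋ (suc n)) ⟨
    2 ^ suc ⌊log₂ suc (suc n + suc n) ⌋ ∎

sumLog₂ : ℕ → ℕ
sumLog₂ zero    = 0
sumLog₂ (suc m) = sumLog₂ m + ⌊log₂ suc m ⌋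

sumLog₂[1+n+n] : ∀ n → sumLog₂ (suc (n + n)) ≡ sumLog₂ n + sumLog₂ n + (n + n)
sumLog₂[2+n+n] : ∀ n → sumLog₂ (suc n + suc n) ≡ sumLog₂ n + sumLog₂ (suc n) + (n + suc n)

sumLog₂[1+n+n] zero    = refl
sumLog₂[1+n+n] (suc n) = begin-equality
  sumLog₂ (suc n + suc n) + ⌊log₂ suc (suc n + suc n) ⌋
    ≡⟨ cong₂ _+_ (sumLog₂[2+n+n] n) (⌊log₂[1+n+n]⌋≡1+⌊log₂n⌋ (suc n)) ⟩
  sumLog₂ n + sumLog₂ (suc n) + (n + suc n) + (1 + ℓ)
    ≡⟨ regroup (sumLog₂ n) ℓ n ⟩
  sumLog₂ (suc n) + sumLog₂ (suc n) + (suc n + suc n) ∎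
  where
  ℓ : ℕ
  ℓ = ⌊log₂ suc n ⌋
  regroup : ∀ b l n → b + (b + l) + (n + suc n) + (1 + l) ≡ (b + l) + (b + l) + (suc n + suc n)
  regroup = solve-∀

sumLog₂[2+n+n] n = begin-equality
  sumLog₂ (n + suc n) + ⌊log₂ (suc n + suc n) ⌋
    ≡⟨ cong (λ k → sumLog₂ k + ⌊log₂ (suc n + suc n) ⌋) (+-suc n n) ⟩
  sumLog₂ (suc (n + n)) + ⌊log₂ (suc n + suc n) ⌋
    ≡⟨ cong₂ _+_ (sumLog₂[1+n+n] n) (⌊log₂[n+n]⌋≡1+⌊log₂n⌋ (suc n)) ⟩
  sumLog₂ n + sumLog₂ n + (n + n) + (1 + ℓ)
    ≡⟨ regroup (sumLog₂ n) ℓ n ⟩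
  sumLog₂ n + sumLog₂ (suc n) + (n + suc n) ∎
  where
  ℓ : ℕ
  ℓ = ⌊log₂ suc n ⌋
  regroup : ∀ b l n → b + b + (n + n) + (1 + l) ≡ b + (b + l) + (n + suc n)
  regroup = solve-∀

-- Moving a node from the larger part to the smaller changes the bound by
-- ⌊log₂ (1 + a)⌋ − ⌊log₂ (1 + b)⌋ ≤ 0, so balanced splits are the extreme case.
sumLog₂-exchange : ∀ {a b} → a ≤ b →
  sumLog₂ (suc (suc a + b)) ≤ sumLog₂ (suc a) + sumLog₂ b + (suc a + b) →
  sumLog₂ (suc (a + suc b)) ≤ sumLog₂ a + sumLog₂ (suc b) + (a + suc b)
sumLog₂-exchange {a} {b} a≤b bound = begin
  sumLog₂ (suc (a + suc b))                                   ≡⟨ cong (sumLog₂ ∘ ℕ.suc) (+-suc a b) ⟩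
  sumLog₂ (suc (suc a + b))                                   ≤⟨ bound ⟩
  sumLog₂ a + ⌊log₂ suc a ⌋ + sumLog₂ b + (suc a + b)         ≤⟨ +-monoˡ-≤ (suc a + b) (+-monoˡ-≤ (sumLog₂ b)
                                                                   (+-monoʳ-≤ (sumLog₂ a) (⌊log₂⌋-mono-≤ (s≤s a≤b)))) ⟩
  sumLog₂ a + ⌊log₂ suc b ⌋ + sumLog₂ b + (suc a + b)         ≡⟨ regroup (sumLog₂ a) (sumLog₂ b) ⌊log₂ suc b ⌋ a b ⟩
  sumLog₂ a + sumLog₂ (suc b) + (a + suc b)                   ∎
  where
  regroup : ∀ x y l a b → x + l + y + (suc a + b) ≡ x + (y + l) + (a + suc b)
  regroup = solve-∀

sumLog₂-split-gap : ∀ d a → sumLog₂ (suc (a + (d + a))) ≤ sumLog₂ a + sumLog₂ (d + a) + (a + (d + a))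
sumLog₂-split-gap zero          a = ≤-reflexive (sumLog₂[1+n+n] a)
sumLog₂-split-gap (suc zero)    a = ≤-reflexive (sumLog₂[2+n+n] a)
sumLog₂-split-gap (suc (suc d)) a = sumLog₂-exchange (≤-trans (m≤n+m a d) (n≤1+n (d + a)))
  (subst (λ b → sumLog₂ (suc (suc a + b)) ≤ sumLog₂ (suc a) + sumLog₂ b + (suc a + b))
         (+-suc d a) (sumLog₂-split-gap d (suc a)))

sumLog₂-split-ordered : ∀ {a b} → a ≤ b → sumLog₂ (suc (a + b)) ≤ sumLog₂ a + sumLog₂ b + (a + b)
sumLog₂-split-ordered {a} {b} a≤b =
  subst (λ b → sumLog₂ (suc (a + b)) ≤ sumLog₂ a + sumLog₂ b + (a + b))
        (m∸n+n≡m a≤b) (sumLog₂-split-gap (b ∸ a) a)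

sumLog₂-split : ∀ a b → sumLog₂ (suc (a + b)) ≤ sumLog₂ a + sumLog₂ b + (a + b)
sumLog₂-split a b with ≤-total a b
... | inj₁ a≤b = sumLog₂-split-ordered a≤b
... | inj₂ b≤a = subst₂ _≤_ (cong (sumLog₂ ∘ ℕ.suc) (+-comm b a))
                       (cong₂ _+_ (+-comm (sumLog₂ b) (sumLog₂ a)) (+-comm b a))
                       (sumLog₂-split-ordered b≤a)

-- Follows from the closed form sumLog₂ n = (n + 1) ⌊log₂ n⌋ + 2 − 2 ^ (1 + ⌊log₂ n⌋) and 2 ^ ⌊log₂ n⌋ ≤ n.
sumLog₂-lower : ∀ n → suc (suc n) * ⌊log₂ suc n ⌋ + 2 ≤ sumLog₂ (suc n) + (suc n + suc n)
sumLog₂-lower = binary-induction P ≤-refl double double+1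
  where
  P : ℕ → Set
  P m = suc m * ⌊log₂ m ⌋ + 2 ≤ sumLog₂ m + (m + m)

  twice : ∀ m → P m →
    (suc m * ⌊log₂ m ⌋ + 2) + (suc m * ⌊log₂ m ⌋ + 2) + (m + m) ≤ sumLog₂ (suc (m + m)) + ((m + m) + (m + m))
  twice m ih = begin
    (suc m * ⌊log₂ m ⌋ + 2) + (suc m * ⌊log₂ m ⌋ + 2) + (m + m) ≤⟨ +-monoˡ-≤ (m + m) (+-mono-≤ ih ih) ⟩
    (sumLog₂ m + (m + m)) + (sumLog₂ m + (m + m)) + (m + m)     ≡⟨ regroup (sumLog₂ m) (m + m) ⟩
    (sumLog₂ m + sumLog₂ m + (m + m)) + ((m + m) + (m + m))     ≡⟨ cong (_+ ((m + m) + (m + m))) (sumLog₂[1+n+n] m) ⟨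
    sumLog₂ (suc (m + m)) + ((m + m) + (m + m))                 ∎
    where
    regroup : ∀ b k → (b + k) + (b + k) + k ≡ (b + b + k) + (k + k)
    regroup = solve-∀

  double : ∀ n → P (suc n) → P (suc n + suc n)
  double n ih = +-cancelʳ-≤ (1 + ℓ) _ _ (begin
    suc (m + m) * ⌊log₂ (m + m) ⌋ + 2 + (1 + ℓ)
      ≡⟨ cong (λ l → suc (m + m) * l + 2 + (1 + ℓ)) (⌊log₂[n+n]⌋≡1+⌊log₂n⌋ m) ⟩
    suc (m + m) * (1 + ℓ) + 2 + (1 + ℓ)
      ≡⟨ expand m ℓ ⟩
    (suc m * ℓ + 2) + (suc m * ℓ + 2) + (m + m)
      ≤⟨ twice m ih ⟩
    sumLog₂ (suc (m + m)) + ((m + m) + (m + m))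
      ≡⟨ cong (λ l → sumLog₂ (m + m) + l + ((m + m) + (m + m))) (⌊log₂[1+n+n]⌋≡1+⌊log₂n⌋ m) ⟩
    sumLog₂ (m + m) + (1 + ℓ) + ((m + m) + (m + m))
      ≡⟨ xy∙z≈xz∙y (sumLog₂ (m + m)) (1 + ℓ) ((m + m) + (m + m)) ⟩
    sumLog₂ (m + m) + ((m + m) + (m + m)) + (1 + ℓ) ∎)
    where
    m ℓ : ℕ
    m = suc n
    ℓ = ⌊log₂ m ⌋
    expand : ∀ m l → suc (m + m) * (1 + l) + 2 + (1 + l) ≡ (suc m * l + 2) + (suc m * l + 2) + (m + m)
    expand = solve-∀

  double+1 : ∀ n → P (suc n) → P (suc (suc n + suc n))
  double+1 n ih = begin
    suc (suc (m + m)) * ⌊log₂ suc (m + m) ⌋ + 2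
      ≡⟨ cong (λ l → suc (suc (m + m)) * l + 2) (⌊log₂[1+n+n]⌋≡1+⌊log₂n⌋ m) ⟩
    suc (suc (m + m)) * (1 + ℓ) + 2
      ≡⟨ expand m ℓ ⟩
    (suc m * ℓ + 2) + (suc m * ℓ + 2) + (m + m)
      ≤⟨ twice m ih ⟩
    sumLog₂ (suc (m + m)) + ((m + m) + (m + m))
      ≤⟨ +-monoʳ-≤ (sumLog₂ (suc (m + m))) (widen (m + m)) ⟩
    sumLog₂ (suc (m + m)) + (suc (m + m) + suc (m + m)) ∎
    where
    m ℓ : ℕ
    m = suc n
    ℓ = ⌊log₂ m ⌋
    expand : ∀ m l → suc (suc (m + m)) * (1 + l) + 2 ≡ (suc m * l + 2) + (suc m * l + 2) + (m + m)
    expand = solve-∀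
    widen : ∀ k → k + k ≤ suc k + suc k
    widen k = +-mono-≤ (n≤1+n k) (n≤1+n k)

n^n≤2^[sumLog₂n+3n] : ∀ n → n ^ n ≤ 2 ^ (sumLog₂ n + 3 * n)
n^n≤2^[sumLog₂n+3n] zero      = ≤-refl
n^n≤2^[sumLog₂n+3n] n@(suc m) = begin
  n ^ n                      ≤⟨ ^-monoˡ-≤ n (<⇒≤ (n<2^[1+⌊log₂n⌋] n)) ⟩
  (2 ^ suc ℓ) ^ n            ≡⟨ ^-*-assoc 2 (suc ℓ) n ⟩
  2 ^ (suc ℓ * n)            ≤⟨ ^-monoʳ-≤ 2 exponent ⟩
  2 ^ (sumLog₂ n + 3 * n)    ∎
  where
  ℓ : ℕ
  ℓ = ⌊log₂ n ⌋
  exponent : suc ℓ * n ≤ sumLog₂ n + 3 * n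
  exponent = begin
    n + ℓ * n                    ≡⟨ cong (n +_) (*-comm ℓ n) ⟩
    n + n * ℓ                    ≤⟨ +-monoʳ-≤ n (≤-trans (m≤n+m (n * ℓ) ℓ) (m≤m+n (suc n * ℓ) 2)) ⟩
    n + (suc n * ℓ + 2)          ≤⟨ +-monoʳ-≤ n (sumLog₂-lower m) ⟩
    n + (sumLog₂ n + (n + n))    ≡⟨ regroup (sumLog₂ n) n ⟩
    sumLog₂ n + 3 * n            ∎
    where
    regroup : ∀ b n → n + (b + (n + n)) ≡ b + 3 * n
    regroup = solve-∀

n^[kn]≤2^[[1+k]e] : ∀ k n e → 2 ^ (3 * suc k) ≤ n → sumLog₂ n ≤ e → n ^ (k * n) ≤ 2 ^ (suc k * e)
n^[kn]≤2^[[1+k]e] k n e large sumLog₂≤e = begin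
  n ^ (k * n)                 ≤⟨ *-cancelʳ-≤ (n ^ (k * n)) (2 ^ (suc k * sumLog₂ n)) (2 ^ c) {{m^n≢0 2 c}} padded ⟩
  2 ^ (suc k * sumLog₂ n)     ≤⟨ ^-monoʳ-≤ 2 (*-monoʳ-≤ (suc k) sumLog₂≤e) ⟩
  2 ^ (suc k * e)             ∎
  where
  c : ℕ
  c = 3 * suc k * n
  padded : n ^ (k * n) * 2 ^ c ≤ 2 ^ (suc k * sumLog₂ n) * 2 ^ c
  padded = begin
    n ^ (k * n) * 2 ^ c                    ≡⟨ cong (n ^ (k * n) *_) (^-*-assoc 2 (3 * suc k) n) ⟨
    n ^ (k * n) * (2 ^ (3 * suc k)) ^ n    ≤⟨ *-monoʳ-≤ (n ^ (k * n)) (^-monoˡ-≤ n large) ⟩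
    n ^ (k * n) * n ^ n                    ≡⟨ ^-distribˡ-+-* n (k * n) n ⟨
    n ^ (k * n + n)                        ≡⟨ cong (n ^_) (trans (+-comm (k * n) n) (*-comm (suc k) n)) ⟩
    n ^ (n * suc k)                        ≡⟨ ^-*-assoc n n (suc k) ⟨
    (n ^ n) ^ suc k                        ≤⟨ ^-monoˡ-≤ (suc k) (n^n≤2^[sumLog₂n+3n] n) ⟩
    (2 ^ (sumLog₂ n + 3 * n)) ^ suc k      ≡⟨ ^-*-assoc 2 (sumLog₂ n + 3 * n) (suc k) ⟩
    2 ^ ((sumLog₂ n + 3 * n) * suc k)      ≡⟨ cong (2 ^_) (regroup (sumLog₂ n) n k) ⟩
    2 ^ (suc k * sumLog₂ n + c)            ≡⟨ ^-distribˡ-+-* 2 (suc k * sumLog₂ n) c ⟩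
    2 ^ (suc k * sumLog₂ n) * 2 ^ c        ∎
    where
    regroup : ∀ b n k → (b + 3 * n) * suc k ≡ suc k * b + 3 * suc k * n
    regroup = solve-∀

sumFrom : ℕ → ℕ → (ℕ → ℕ) → ℕ
sumFrom i zero    f = 0
sumFrom i (suc m) f = f i + sumFrom (suc i) m f

sumFrom-++ : ∀ i a b f → sumFrom i (a + b) f ≡ sumFrom i a f + sumFrom (i + a) b f
sumFrom-++ i zero    b f = cong (λ j → sumFrom j b f) (sym (+-identityʳ i))
sumFrom-++ i (suc a) b f = begin-equality
  f i + sumFrom (suc i) (a + b) f
    ≡⟨ cong (f i +_) (sumFrom-++ (suc i) a b f) ⟩
  f i + (sumFrom (suc i) a f + sumFrom (suc i + a) b f)
    ≡⟨ +-assoc (f i) _ _ ⟨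
  f i + sumFrom (suc i) a f + sumFrom (suc i + a) b f
    ≡⟨ cong (λ j → f i + sumFrom (suc i) a f + sumFrom j b f) (+-suc i a) ⟨
  f i + sumFrom (suc i) a f + sumFrom (i + suc a) b f ∎

sumFrom-mono : ∀ i m {f g} → (∀ p → f p ≤ g p) → sumFrom i m f ≤ sumFrom i m g
sumFrom-mono i zero    f≤g = z≤n
sumFrom-mono i (suc m) f≤g = +-mono-≤ (f≤g i) (sumFrom-mono (suc i) m f≤g)

sumFrom-+ : ∀ i m f g → sumFrom i m (λ p → f p + g p) ≡ sumFrom i m f + sumFrom i m g
sumFrom-+ i zero    f g = refl
sumFrom-+ i (suc m) f g = begin-equality
  f i + g i + sumFrom (suc i) m (λ p → f p + g p)             ≡⟨ cong (f i + g i +_) (sumFrom-+ (suc i) m f g) ⟩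
  f i + g i + (sumFrom (suc i) m f + sumFrom (suc i) m g)     ≡⟨ interchange (f i) (g i) _ _ ⟩
  f i + sumFrom (suc i) m f + (g i + sumFrom (suc i) m g)     ∎

InInterval : ℕ → ℕ → ℕ → Set
InInterval i m p = i ≤ p × p < i + m

m≤sumFrom : ∀ i m {f} → (∀ p → InInterval i m p → 1 ≤ f p) → m ≤ sumFrom i m f
m≤sumFrom i zero    pos = z≤n
m≤sumFrom i (suc m) pos = +-mono-≤ (pos i (≤-refl , m<m+n i z<s))
  (m≤sumFrom (suc i) m λ p (i<p , p<) → pos p (<⇒≤ i<p , ≤-trans p< (≤-reflexive (sym (+-suc i m)))))

[1+i+a]+b≡i+[1+a+b] : ∀ i a b → suc (i + a) + b ≡ i + suc (a + b)
[1+i+a]+b≡i+[1+a+b] i a b = trans (cong suc (+-assoc i a b)) (sym (+-suc i (a + b)))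

InInterval-split : ∀ {i m p} → InInterval i (suc m) p → ∃₂ λ a b → p ≡ i + a × m ≡ a + b
InInterval-split {i} {m} {p} (i≤p , p<i+1+m) = p ∸ i , m ∸ (p ∸ i) , sym (m+[n∸m]≡n i≤p) , sym (m+[n∸m]≡n p∸i≤m)
  where
  p∸i≤m : p ∸ i ≤ m
  p∸i≤m = s≤s⁻¹ (m<n+o⇒m∸n<o p i p<i+1+m)

module IntervalMass (w : ℕ → ℕ → ℕ) where

  mass : ℕ → ℕ → ℕ
  mass i m = sumFrom i m λ p → sumFrom i m (w p)

  links : ℕ → ℕ → ℕ → ℕ
  links h i m = sumFrom i m λ p → w h p + w p h

  IsHub : ℕ → ℕ → ℕ → Set
  IsHub i m h = InInterval i m h × (∀ p → InInterval i m p → p ≢ h → 1 ≤ w h p + w p h)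

  -- Only the pairs joining the two sides, and (h, h), are dropped.
  mass-around : ∀ i a b → let h = i + a in
    mass i a + mass (suc h) b + (links h i a + links h (suc h) b) ≤ mass i (a + suc b)
  mass-around i a b = begin
    mass i a + mass R b + (links h i a + links h R b)
      ≡⟨ cong₂ (λ x y → mass i a + mass R b + (x + y)) (sumFrom-+ i a (w h) (flip w h)) (sumFrom-+ R b (w h) (flip w h)) ⟩
    mass i a + mass R b + ((Σˡ (w h) + Σˡ (flip w h)) + (Σʳ (w h) + Σʳ (flip w h)))
      ≡⟨ regroup (mass i a) (mass R b) (Σˡ (w h)) (Σˡ (flip w h)) (Σʳ (w h)) (Σʳ (flip w h)) ⟩
    (mass i a + Σˡ (flip w h)) + ((Σˡ (w h) + Σʳ (w h)) + (Σʳ (flip w h) + mass R b))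
      ≤⟨ +-mono-≤ left (+-mono-≤ centre right) ⟩
    Σˡ row + (row h + Σʳ row)
      ≡⟨ sumFrom-++ i a (suc b) row ⟨
    mass i (a + suc b) ∎
    where
    h R : ℕ
    h = i + a
    R = suc h
    Σˡ Σʳ : (ℕ → ℕ) → ℕ
    Σˡ = sumFrom i a
    Σʳ = sumFrom R b
    row : ℕ → ℕ
    row p = sumFrom i (a + suc b) (w p)
    row-split : ∀ p → row p ≡ Σˡ (w p) + (w p h + Σʳ (w p))
    row-split p = sumFrom-++ i a (suc b) (w p)
    regroup : ∀ m₁ m₂ x₁ y₁ x₂ y₂ → m₁ + m₂ + ((x₁ + y₁) + (x₂ + y₂)) ≡ (m₁ + y₁) + ((x₁ + x₂) + (y₂ + m₂))
    regroup = solve-∀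
    left : mass i a + Σˡ (flip w h) ≤ Σˡ row
    left = begin
      mass i a + Σˡ (flip w h)      ≡⟨ sumFrom-+ i a (λ p → Σˡ (w p)) (flip w h) ⟨
      Σˡ (λ p → Σˡ (w p) + w p h)   ≤⟨ sumFrom-mono i a (λ p → ≤-trans (+-monoʳ-≤ (Σˡ (w p)) (m≤m+n (w p h) (Σʳ (w p))))
                                                                       (≤-reflexive (sym (row-split p)))) ⟩
      Σˡ row                        ∎
    centre : Σˡ (w h) + Σʳ (w h) ≤ row h
    centre = ≤-trans (+-monoʳ-≤ (Σˡ (w h)) (m≤n+m (Σʳ (w h)) (w h h))) (≤-reflexive (sym (row-split h)))
    right : Σʳ (flip w h) + mass R b ≤ Σʳ row
    right = begin
      Σʳ (flip w h) + mass R b      ≡⟨ sumFrom-+ R b (flip w h) (λ p → Σʳ (w p)) ⟨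
      Σʳ (λ p → w p h + Σʳ (w p))   ≤⟨ sumFrom-mono R b (λ p → ≤-trans (m≤n+m (w p h + Σʳ (w p)) (Σˡ (w p)))
                                                                       (≤-reflexive (sym (row-split p)))) ⟩
      Σʳ row                        ∎

  mass-split : ∀ {i a b} → IsHub i (suc (a + b)) (i + a) →
    mass i a + mass (suc (i + a)) b + (a + b) ≤ mass i (suc (a + b))
  mass-split {i} {a} {b} (_ , hub) = begin
    mass i a + mass (suc h) b + (a + b)
      ≤⟨ +-monoʳ-≤ (mass i a + mass (suc h) b) (+-mono-≤ left right) ⟩
    mass i a + mass (suc h) b + (links h i a + links h (suc h) b) ≤⟨ mass-around i a b ⟩
    mass i (a + suc b)
      ≡⟨ cong (mass i) (+-suc a b) ⟩
    mass i (suc (a + b)) ∎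
    where
    h : ℕ
    h = i + a
    left : a ≤ links h i a
    left = m≤sumFrom i a λ p (i≤p , p<h) →
      hub p (i≤p , <-≤-trans p<h (+-monoʳ-≤ i (m≤n⇒m≤1+n (m≤m+n a b)))) (<⇒≢ p<h)
    right : b ≤ links h (suc h) b
    right = m≤sumFrom (suc h) b λ p (h<p , p<) →
      hub p (≤-trans (m≤m+n i a) (<⇒≤ h<p) , <-≤-trans p< (≤-reflexive ([1+i+a]+b≡i+[1+a+b] i a b))) (>⇒≢ h<p)

  sumLog₂≤mass : ∀ {n} → (∀ i m → i + suc m ≤ n → ∃[ h ] IsHub i (suc m) h) →
                 ∀ m i → i + m ≤ n → sumLog₂ m ≤ mass i m
  sumLog₂≤mass {n} hubs = <-rec _ step
    where
    step : ∀ m → (∀ {k} → k < m → ∀ i → i + k ≤ n → sumLog₂ k ≤ mass i k) →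
           ∀ i → i + m ≤ n → sumLog₂ m ≤ mass i m
    step zero    _  _ _ = z≤n
    step (suc m) ih i i+m≤n with hubs i m i+m≤n
    ... | h , hub with InInterval-split (proj₁ hub)
    ... | a , b , refl , refl = begin
      sumLog₂ (suc (a + b))                       ≤⟨ sumLog₂-split a b ⟩
      sumLog₂ a + sumLog₂ b + (a + b)             ≤⟨ +-monoˡ-≤ (a + b) (+-mono-≤ left right) ⟩
      mass i a + mass (suc (i + a)) b + (a + b)   ≤⟨ mass-split hub ⟩
      mass i (suc (a + b))                        ∎
      where
      left : sumLog₂ a ≤ mass i a
      left = ih (s≤s (m≤m+n a b)) i (≤-trans (+-monoʳ-≤ i (m≤n⇒m≤1+n (m≤m+n a b))) i+m≤n)
      right : sumLog₂ b ≤ mass (suc (i + a)) b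
      right = ih (s≤s (m≤n+m b a)) (suc (i + a)) (subst (_≤ n) (sym ([1+i+a]+b≡i+[1+a+b] i a b)) i+m≤n)

extendByZero : ∀ {n} → (Fin n → Fin n → ℕ) → ℕ → ℕ → ℕ
extendByZero {n} e p q with p <? n | q <? n
... | yes p<n | yes q<n = e (fromℕ< p<n) (fromℕ< q<n)
... | _       | _       = 0

extendByZero-toℕ : ∀ {n} (e : Fin n → Fin n → ℕ) x y → extendByZero e (toℕ x) (toℕ y) ≡ e x y
extendByZero-toℕ {n} e x y with toℕ x <? n | toℕ y <? n
... | yes x<n | yes y<n = cong₂ e (Fin.fromℕ<-toℕ x x<n) (Fin.fromℕ<-toℕ y y<n)
... | no  x≮n | _       = contradiction (Fin.toℕ<n x) x≮n
... | yes _   | no  y≮n = contradiction (Fin.toℕ<n y) y≮n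

sumFrom-suc : ∀ i m f → sumFrom (suc i) m f ≡ sumFrom i m (f ∘ ℕ.suc)
sumFrom-suc i zero    f = refl
sumFrom-suc i (suc m) f = cong (f (suc i) +_) (sumFrom-suc (suc i) m f)

sumFrom0≡∑ : ∀ n f → sumFrom 0 n f ≡ ∑[ x < n ] f (toℕ x)
sumFrom0≡∑ zero    f = refl
sumFrom0≡∑ (suc n) f = cong (f 0 +_) (trans (sumFrom-suc 0 n f) (sumFrom0≡∑ n (f ∘ ℕ.suc)))

mass-extendByZero : ∀ {n} (e : Fin n → Fin n → ℕ) →
  IntervalMass.mass (extendByZero e) 0 n ≡ ∑[ x < n ] ∑[ y < n ] e x y
mass-extendByZero {n} e = trans (sumFrom0≡∑ n _)
  (sum-cong-≗ λ x → trans (sumFrom0≡∑ n _) (sum-cong-≗ (extendByZero-toℕ e x)))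

∑∑-permute : ∀ {n} (π : Fin n ↔ Fin n) (e : Fin n → Fin n → ℕ) →
  ∑[ u < n ] ∑[ v < n ] e u v ≡ ∑[ x < n ] ∑[ y < n ] e (Inverse.to π x) (Inverse.to π y)
∑∑-permute π e = trans (∑-permute _ π) (sum-cong-≗ λ x → ∑-permute (e (Inverse.to π x)) π)

sum-tabulate : ∀ {n} (f : Fin n → ℕ) → List.sum (tabulate f) ≡ ∑[ x < n ] f x
sum-tabulate {zero}  f = refl
sum-tabulate {suc n} f = cong (f zero +_) (sum-tabulate (f ∘ Fin.suc))

sum-map-allFin : ∀ {n} (f : Fin n → ℕ) → List.sum (map f (allFin n)) ≡ ∑[ x < n ] f x
sum-map-allFin {n} f = trans (cong List.sum (map-tabulate id f)) (sum-tabulate f)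

injective⇒strictlySurjective : ∀ {m} {f : Fin m → Fin m} → Injective _≡_ _≡_ f → StrictlySurjective _≡_ f
injective⇒strictlySurjective {suc m} {f} f-inj y with Fin.any? (λ x → f x Fin.≟ y)
... | yes hit  = hit
... | no  miss = contradiction (Fin.injective⇒≤ avoid-inj) (1+n≰n {m})
  where
  y≢f : ∀ x → y ≢ f x
  y≢f x y≡fx = miss (x , sym y≡fx)
  avoid : Fin (suc m) → Fin m
  avoid x = punchOut (y≢f x)
  avoid-inj : Injective _≡_ _≡_ avoid
  avoid-inj {x} {x′} eq = f-inj (Fin.punchOut-injective (y≢f x) (y≢f x′) eq)

injective-into-interval⇒onto : ∀ {i m} (f : Fin m → ℕ) → Injective _≡_ _≡_ f → (∀ x → InInterval i m (f x)) →
                               ∀ p → InInterval i m p → ∃ λ x → f x ≡ p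
injective-into-interval⇒onto {i} {m} f f-inj f∈I p p∈I =
  map₂ (λ {x} → offset-injective (f∈I x) p∈I) (injective⇒strictlySurjective f-offset-inj (offset p∈I))
  where
  offset : ∀ {q} → InInterval i m q → Fin m
  offset {q} (i≤q , q<i+m) = fromℕ< (subst (q ∸ i <_) (m+n∸m≡n i m) (∸-monoˡ-< q<i+m i≤q))
  offset-injective : ∀ {q r} (q∈I : InInterval i m q) (r∈I : InInterval i m r) → offset q∈I ≡ offset r∈I → q ≡ r
  offset-injective (i≤q , _) (i≤r , _) eq =
    ∸-cancelʳ-≡ i≤q i≤r (trans (sym (Fin.toℕ-fromℕ< _)) (trans (cong toℕ eq) (Fin.toℕ-fromℕ< _)))
  f-offset-inj : Injective _≡_ _≡_ (offset ∘ f∈I)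
  f-offset-inj eq = f-inj (offset-injective (f∈I _) (f∈I _) eq)

Adj-sym : ∀ {n} (G : SimpleGraph n) {u v} → Adj G u v → Adj G v u
Adj-sym G {u} {v} uv = trans (SimpleGraph.sym G v u) uv

starAdj : ∀ {m} → Fin (suc m) → Fin (suc m) → Bool
starAdj zero    (suc _) = true
starAdj (suc _) zero    = true
starAdj _       _       = false

star : ∀ m → SimpleGraph (suc m)
star m = record { adj = starAdj ; sym = symmetric ; irrefl = irreflexive }
  where
  symmetric : ∀ u v → starAdj u v ≡ starAdj v u
  symmetric zero    zero    = refl
  symmetric zero    (suc _) = refl
  symmetric (suc _) zero    = refl
  symmetric (suc _) (suc _) = refl
  irreflexive : ∀ u → starAdj u u ≡ false
  irreflexive zero    = refl
  irreflexive (suc _) = refl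

star-connected : ∀ m → Connected (star m)
star-connected m u v = toCentre u (fromCentre v)
  where
  fromCentre : ∀ v → Walk (star m) zero v
  fromCentre zero    = nil
  fromCentre (suc v) = cons refl nil
  toCentre : ∀ u {v} → Walk (star m) zero v → Walk (star m) u v
  toCentre zero    walk = walk
  toCentre (suc u) walk = cons refl walk

star-leaf-neighbour : ∀ {m} {x : Fin m} {y} → Adj (star m) (suc x) y → y ≡ zero
star-leaf-neighbour {y = zero} _ = refl

star-centre : ∀ {m} {u v w : Fin (suc m)} → Adj (star m) v u → Adj (star m) v w → u ≢ w → v ≡ zero
star-centre {v = zero}  _  _  _   = refl
star-centre {v = suc _} vu vw u≢w = contradiction (trans (star-leaf-neighbour vu) (sym (star-leaf-neighbour vw))) u≢w

star-has-no-P₄ : ∀ {m} {u v w x : Fin (suc m)} →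
  Adj (star m) u v → Adj (star m) v w → Adj (star m) w x → u ≢ w → v ≢ x → ⊥
star-has-no-P₄ {m} uv vw wx u≢w v≢x
  with star-centre (Adj-sym (star m) uv) vw u≢w | star-centre (Adj-sym (star m) vw) wx v≢x
... | refl | refl = contradiction vw λ ()

star-acyclic : ∀ m → ¬ HasCycle (star m)
star-acyclic m (zero  , c , c-inj , path , closing) =
  star-has-no-P₄ (path zero) (path (suc zero)) closing (contraInjective c-inj λ ()) (contraInjective c-inj λ ())
star-acyclic m (suc l , c , c-inj , path , closing) =
  star-has-no-P₄ (path zero) (path (suc zero)) (path (suc (suc zero))) (contraInjective c-inj λ ()) (contraInjective c-inj λ ())

star-isTree : ∀ m → IsTree (star m)
star-isTree m = star-connected m , star-acyclic m

forwardEdge : ∀ {n} → SimpleGraph n → Fin n → Fin n → ℕ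
forwardEdge G u v = if does (u Fin.<? v) ∧ adj G u v then 1 else 0

-- The summand of edgeCount is local to its definition; unification recovers it.
edgeCount-indicator : ∀ {n} (G : SimpleGraph n) →
  Σ (Fin n → Fin n → ℕ) λ ind → edgeCount G ≡ List.sum (map (λ u → List.sum (map (ind u) (allFin n))) (allFin n))
edgeCount-indicator G = _ , refl

edgeCount-indicator≗forwardEdge : ∀ {n} (G : SimpleGraph n) u v → proj₁ (edgeCount-indicator G) u v ≡ forwardEdge G u v
edgeCount-indicator≗forwardEdge G u v with does (u Fin.<? v) | adj G u v
... | true  | true  = refl
... | true  | false = refl
... | false | _     = refl

edgeCount≡∑∑forwardEdge : ∀ {n} (G : SimpleGraph n) → edgeCount G ≡ ∑[ u < n ] ∑[ v < n ] forwardEdge G u v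
edgeCount≡∑∑forwardEdge {n} G = begin-equality
  edgeCount G
    ≡⟨ proj₂ (edgeCount-indicator G) ⟩
  List.sum (map (λ u → List.sum (map (ind u) (allFin n))) (allFin n))
    ≡⟨ sum-map-allFin (λ u → List.sum (map (ind u) (allFin n))) ⟩
  ∑[ u < n ] List.sum (map (ind u) (allFin n))
    ≡⟨ sum-cong-≗ (λ u → sum-map-allFin (ind u)) ⟩
  ∑[ u < n ] ∑[ v < n ] ind u v
    ≡⟨ sum-cong-≗ (λ u → sum-cong-≗ (edgeCount-indicator≗forwardEdge G u)) ⟩
  ∑[ u < n ] ∑[ v < n ] forwardEdge G u v ∎
  where
  ind : Fin n → Fin n → ℕ
  ind = proj₁ (edgeCount-indicator G)

forwardEdge≡1 : ∀ {n} (G : SimpleGraph n) {u v} → u Fin.< v → Adj G u v → forwardEdge G u v ≡ 1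
forwardEdge≡1 G {u} {v} u<v uv rewrite dec-true (u Fin.<? v) u<v | uv = refl

forwardEdge-adjacent : ∀ {n} (G : SimpleGraph n) {u v} → Adj G u v → 1 ≤ forwardEdge G u v + forwardEdge G v u
forwardEdge-adjacent G {u} {v} uv with Fin.<-cmp u v
... | tri< u<v _ _ = subst (λ k → 1 ≤ k + forwardEdge G v u) (sym (forwardEdge≡1 G u<v uv)) (s≤s z≤n)
... | tri≈ _ refl _ = contradiction (trans (sym uv) (SimpleGraph.irrefl G u)) λ ()
... | tri> _ _ v<u = subst (λ k → 1 ≤ forwardEdge G u v + k) (sym (forwardEdge≡1 G v<u (Adj-sym G uv))) (m≤n+m 1 _)

positionWeight : ∀ {n} → SimpleGraph n → (Fin n → Fin n) → ℕ → ℕ → ℕ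
positionWeight G ord = extendByZero λ x y → forwardEdge G (ord x) (ord y)

star-centre-isHub : ∀ {n} (G : SimpleGraph n) ord {i m} (c : ContainsInInterval G ord i (star m)) →
  IntervalMass.IsHub (positionWeight G ord) i (suc m) (toℕ (proj₁ c zero))
star-centre-isHub {n} G ord {i} {m} (φ , φ-inj , φ∈I , φ-hom) = φ∈I zero , linked
  where
  e : Fin n → Fin n → ℕ
  e x y = forwardEdge G (ord x) (ord y)
  w : ℕ → ℕ → ℕ
  w = extendByZero e
  linked : ∀ p → InInterval i (suc m) p → p ≢ toℕ (φ zero) → 1 ≤ w (toℕ (φ zero)) p + w p (toℕ (φ zero))
  linked p p∈I p≢h with injective-into-interval⇒onto (toℕ ∘ φ) (φ-inj ∘ Fin.toℕ-injective) φ∈I p p∈I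
  ... | zero  , refl = contradiction refl p≢h
  ... | suc x , refl = begin
    1                                                      ≤⟨ forwardEdge-adjacent G (φ-hom zero (suc x) refl) ⟩
    e (φ zero) (φ (suc x)) + e (φ (suc x)) (φ zero)        ≡⟨ cong₂ _+_ (extendByZero-toℕ e _ _) (extendByZero-toℕ e _ _) ⟨
    w (toℕ (φ zero)) (toℕ (φ (suc x))) + w (toℕ (φ (suc x))) (toℕ (φ zero)) ∎

sumLog₂≤edgeCount : ∀ {n} (G : SimpleGraph n) → IntervalUniversal G → sumLog₂ n ≤ edgeCount G
sumLog₂≤edgeCount {n} G (ord , universal) = begin
  sumLog₂ n                                       ≤⟨ sumLog₂≤mass hubs n 0 ≤-refl ⟩
  mass 0 n                                        ≡⟨ mass-extendByZero (λ x y → forwardEdge G (σ x) (σ y)) ⟩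
  ∑[ x < n ] ∑[ y < n ] forwardEdge G (σ x) (σ y) ≡⟨ ∑∑-permute ord (forwardEdge G) ⟨
  ∑[ u < n ] ∑[ v < n ] forwardEdge G u v         ≡⟨ edgeCount≡∑∑forwardEdge G ⟨
  edgeCount G                                     ∎
  where
  σ : Fin n → Fin n
  σ = Inverse.to ord
  open IntervalMass (positionWeight G σ)
  hubs : ∀ i m → i + suc m ≤ n → ∃[ h ] IsHub i (suc m) h
  hubs i m i+m≤n = _ , star-centre-isHub G σ (universal i (suc m) i+m≤n (star m) (star-isTree m))

theorem6p2 : (k : ℕ) → 1 ≤ k → ∃[ N ] ((n : ℕ) → N ≤ n → (G : SimpleGraph n) → IntervalUniversal G → n ^ ((k ∸ 1) * n) ≤ 2 ^ (k * edgeCount G))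
theorem6p2 (suc k) _ = 2 ^ (3 * suc k) , λ n large G universal →
  n^[kn]≤2^[[1+k]e] k n (edgeCount G) large (sumLog₂≤edgeCount G universal)
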